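{- Let $(n,k,\lambda,\mu)$ be a feasible strongly regular parameter set with associated spectrum $k^1,r^f,s^g$, and let $\omega\ge2$ be an integer such that $m=\frac{nk}{\omega(\omega-1)}$ and $\frac{k}{\omega-1}$ are integers. Then for every non-negative integer $\ell$, $m$ divides \[\left(\omega\left(\frac{k}{\omega-1}-1\right)\right)^{\ell}+f\left(\frac{k}{\omega-1}+r-\omega\right)^{\ell}+g\left(\frac{k}{\omega-1}+s-\omega\right)^{\ell}+(m-n)(-\omega)^{\ell}.\]
   Context: For integers $(n,k,\lambda,\mu)$, set $r=\frac12\left[(\lambda-\mu)+\sqrt{(\lambda-\mu)^2+4(k-\mu)}\right]$, $s=\frac12\left[(\lambda-\mu)-\sqrt{(\lambda-\mu)^2+4(k-\mu)}\right]$, $f=\frac12\left[(n-1)-\frac{2k+(n-1)(\lambda-\mu)}{\sqrt{(\lambda-\mu)^2+4(k-\mu)}}\right]$, $g=\frac12\left[(n-1)+\frac{2k+(n-1)(\lambda-\mu)}{\sqrt{(\lambda-\mu)^2+4(k-\mu)}}\right]$ (the associated spectrum $k^1,r^f,s^g$, exponents being multiplicities). The parameter set is called feasible if $(n-k-1)\mu=k(k-\lambda-1)$ and $r,s$ are integers and $f,g$ are positive integers. -}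

module Defs where

open import Data.Nat using (ℕ)
open import Data.Integer using (ℤ; +_; _+_; _-_; _*_; _<_)
open import Data.Product using (_×_)
open import Relation.Binary.PropositionalEquality using (_≡_)

-- Discriminant (λ-μ)^2 + 4(k-μ); written with l for λ and u for μ.
disc : ℤ → ℤ → ℤ → ℤ
disc k l u = (l - u) * (l - u) + + 4 * (k - u)

-- "r, s, f, g are the (well-defined) values of the formulas in the paper":
-- sqrt(disc) = δ is the nonnegative square root (must be nonzero so that
-- f and g are defined), and r,s,f,g equal the displayed expressions
-- (stated after clearing the denominators 2 and 2δ).
record Spectrum (n k l u r s f g : ℤ) : Set where
  field
    δ     : ℕ
    δ-pos : + 0 < + δ
    δ-sq  : disc k l u ≡ + δ * + δ
    r-def : + 2 * r ≡ (l - u) + + δ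
    s-def : + 2 * s ≡ (l - u) - + δ
    f-def : + 2 * f * + δ ≡ (n - + 1) * + δ - (+ 2 * k + (n - + 1) * (l - u))
    g-def : + 2 * g * + δ ≡ (n - + 1) * + δ + (+ 2 * k + (n - + 1) * (l - u))

Feasible : (n k l u r s f g : ℤ) → Set
Feasible n k l u r s f g =
  ((n - k - + 1) * u ≡ k * (k - l - + 1))
  × Spectrum n k l u r s f g
  × (+ 0 < f) × (+ 0 < g)

{-# OPTIONS --safe #-}
-- The number in question is the power sum Σ c (x - ω)^ℓ over the list of
-- (multiplicity, value) pairs (1, q + k), (f, q + r), (g, q + s), (m - n, 0).
-- Translating all values preserves "m divides every power sum", by induction
-- on ℓ for all weightings at once, since (x - ω)^(ℓ+1) = x (x - ω)^ℓ - ω (x - ω)^ℓ.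
-- Untranslated, the power sum is m for j = 0, and for j ≥ 1 it is
-- P_j = (q + k)^j + f (q + r)^j + g (q + s)^j. As q + r and q + s are the roots
-- of a monic integer quadratic, P_(j+2) = α P_(j+1) - β P_j + (k - r)(k - s)(q + k)^j,
-- and (k - r)(k - s) = μ n by the SRG identity. Since n (q + k) = m ω², m divides
-- this forcing term for j ≥ 1, as well as P_1 = n q = m ω and P_2 = n (q² + k).
module Submission where

open import Defs
open import Data.Nat using (ℕ; zero; suc; s≤s; z≤n)
open import Data.Integer using (ℤ; +_; -_; _+_; _-_; _*_; _^_; _≤_; +<+)
open import Data.Integer.Base using (NonZero; >-nonZero)
open import Data.Integer.Divisibility using (_∣_)
open import Data.Integer.Divisibility.Signed as Signed
  using (divides; ∣m∣n⇒∣m+n; ∣m∣n⇒∣m-n; ∣n⇒∣m*n; ∣⇒∣ᵤ)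
import Data.Integer.Properties as ℤP
open import Data.Integer.Tactic.RingSolver using (solve-∀)
open import Data.List using (List; []; _∷_; map)
open import Data.Product using (_×_; _,_; proj₁; map₂)
open import Relation.Binary.PropositionalEquality
  using (_≡_; refl; sym; trans; cong; cong₂; subst; module ≡-Reasoning)

open ≡-Reasoning

powerSum : List (ℤ × ℤ) → ℕ → ℤ
powerSum []             j = + 0
powerSum ((c , x) ∷ ws) j = c * x ^ j + powerSum ws j

translate : ℤ → List (ℤ × ℤ) → List (ℤ × ℤ)
translate a = map (map₂ (_+ a))

scaleByNodes : List (ℤ × ℤ) → List (ℤ × ℤ)
scaleByNodes = map λ (c , x) → c * x , x

powerSum-scaleByNodes : ∀ ws j → powerSum (scaleByNodes ws) j ≡ powerSum ws (suc j)
powerSum-scaleByNodes []             j = refl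
powerSum-scaleByNodes ((c , x) ∷ ws) j =
  cong₂ _+_ (ℤP.*-assoc c x (x ^ j)) (powerSum-scaleByNodes ws j)

powerSum-translate-zero : ∀ a ws → powerSum (translate a ws) 0 ≡ powerSum ws 0
powerSum-translate-zero a []             = refl
powerSum-translate-zero a ((c , x) ∷ ws) = cong (_+_ (c * + 1)) (powerSum-translate-zero a ws)

powerSum-translate-suc : ∀ a ws ℓ →
  powerSum (translate a ws) (suc ℓ) ≡
  powerSum (translate a (scaleByNodes ws)) ℓ + a * powerSum (translate a ws) ℓ
powerSum-translate-suc a []             ℓ = sym (cong (_+_ (+ 0)) (ℤP.*-zeroʳ a))
powerSum-translate-suc a ((c , x) ∷ ws) ℓ = begin
  c * ((x + a) * X) + powerSum (translate a ws) (suc ℓ)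
    ≡⟨ cong (_+_ (c * ((x + a) * X))) (powerSum-translate-suc a ws ℓ) ⟩
  c * ((x + a) * X) + (S + a * T)     ≡⟨ split c x a X S T ⟩
  c * x * X + S + a * (c * X + T)     ∎
  where
  X = (x + a) ^ ℓ
  S = powerSum (translate a (scaleByNodes ws)) ℓ
  T = powerSum (translate a ws) ℓ
  split : ∀ c x a X S T → c * ((x + a) * X) + (S + a * T) ≡ c * x * X + S + a * (c * X + T)
  split = solve-∀

∣powerSum⇒∣powerSum-translate : ∀ {m} a ws → (∀ j → m Signed.∣ powerSum ws j) →
                                ∀ ℓ → m Signed.∣ powerSum (translate a ws) ℓ
∣powerSum⇒∣powerSum-translate {m} a ws m∣ zero =
  subst (m Signed.∣_) (sym (powerSum-translate-zero a ws)) (m∣ 0)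
∣powerSum⇒∣powerSum-translate {m} a ws m∣ (suc ℓ) =
  subst (m Signed.∣_) (sym (powerSum-translate-suc a ws ℓ))
    (∣m∣n⇒∣m+n (∣powerSum⇒∣powerSum-translate a (scaleByNodes ws) m∣scaled ℓ)
               (∣n⇒∣m*n a (∣powerSum⇒∣powerSum-translate a ws m∣ ℓ)))
  where
  m∣scaled : ∀ j → m Signed.∣ powerSum (scaleByNodes ws) j
  m∣scaled j = subst (m Signed.∣_) (sym (powerSum-scaleByNodes ws j)) (m∣ (suc j))

powerSum-zeroNode : ∀ c ws j → powerSum ((c , + 0) ∷ ws) (suc j) ≡ powerSum ws (suc j)
powerSum-zeroNode c ws j =
  trans (cong (_+ powerSum ws (suc j)) (ℤP.*-zeroʳ c)) (ℤP.+-identityˡ _)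

powerSum-three-recurrence : ∀ c f g x y z j →
  let P = powerSum ((c , x) ∷ (f , y) ∷ (g , z) ∷ []) in
  P (suc (suc j)) ≡ (y + z) * P (suc j) - y * z * P j + c * ((x - y) * (x - z)) * x ^ j
powerSum-three-recurrence c f g x y z j = identity c f g x y z (x ^ j) (y ^ j) (z ^ j)
  where
  identity : ∀ c f g x y z X Y Z →
    c * (x * (x * X)) + (f * (y * (y * Y)) + (g * (z * (z * Z)) + + 0)) ≡
    (y + z) * (c * (x * X) + (f * (y * Y) + (g * (z * Z) + + 0)))
      - y * z * (c * X + (f * Y + (g * Z + + 0))) + c * ((x - y) * (x - z)) * X
  identity = solve-∀

∣-recurrence : ∀ {m} (p γ : ℕ → ℤ) (α β : ℤ) →
               (∀ j → p (suc (suc j)) ≡ α * p (suc j) - β * p j + γ j) →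
               m Signed.∣ p 1 → m Signed.∣ p 2 → (∀ j → m Signed.∣ γ (suc j)) →
               ∀ j → m Signed.∣ p (suc j)
∣-recurrence {m} p γ α β rec m∣p₁ m∣p₂ m∣γ j = proj₁ (consecutive j)
  where
  consecutive : ∀ j → m Signed.∣ p (suc j) × m Signed.∣ p (suc (suc j))
  consecutive zero    = m∣p₁ , m∣p₂
  consecutive (suc j) =
    let (m∣pⱼ , m∣pⱼ₊₁) = consecutive j in
    m∣pⱼ₊₁ , subst (m Signed.∣_) (sym (rec (suc j)))
               (∣m∣n⇒∣m+n (∣m∣n⇒∣m-n (∣n⇒∣m*n α m∣pⱼ₊₁) (∣n⇒∣m*n β m∣pⱼ)) (m∣γ j))

module _ {n k l u r s f g : ℤ} (sp : Spectrum n k l u r s f g) where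
  open Spectrum sp

  private
    instance
      δ≢0 : NonZero (+ δ)
      δ≢0 = >-nonZero δ-pos
      2δ≢0 : NonZero (+ 2 * + δ)
      2δ≢0 = ℤP.i*j≢0 (+ 2) (+ δ)
      4δ≢0 : NonZero (+ 4 * + δ)
      4δ≢0 = ℤP.i*j≢0 (+ 4) (+ δ)

  r+s≡l-u : r + s ≡ l - u
  r+s≡l-u = ℤP.*-cancelʳ-≡ _ _ (+ 2) (begin
    (r + s) * + 2                 ≡⟨ expand r s ⟩
    + 2 * r + + 2 * s             ≡⟨ cong₂ _+_ r-def s-def ⟩
    (l - u + + δ) + (l - u - + δ) ≡⟨ collect (l - u) (+ δ) ⟩
    (l - u) * + 2                 ∎)
    where
    expand : ∀ r s → (r + s) * + 2 ≡ + 2 * r + + 2 * s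
    expand = solve-∀
    collect : ∀ L d → (L + d) + (L - d) ≡ L * + 2
    collect = solve-∀

  r*s≡u-k : r * s ≡ u - k
  r*s≡u-k = ℤP.*-cancelʳ-≡ _ _ (+ 4) (begin
    (r * s) * + 4                 ≡⟨ expand r s ⟩
    (+ 2 * r) * (+ 2 * s)         ≡⟨ cong₂ _*_ r-def s-def ⟩
    (l - u + + δ) * (l - u - + δ) ≡⟨ difference-of-squares (l - u) (+ δ) ⟩
    (l - u) * (l - u) - + δ * + δ ≡⟨ cong (λ d → (l - u) * (l - u) - d) (sym δ-sq) ⟩
    (l - u) * (l - u) - disc k l u ≡⟨ unfold-disc k l u ⟩
    (u - k) * + 4                 ∎)
    where
    expand : ∀ r s → (r * s) * + 4 ≡ (+ 2 * r) * (+ 2 * s)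
    expand = solve-∀
    difference-of-squares : ∀ L d → (L + d) * (L - d) ≡ L * L - d * d
    difference-of-squares = solve-∀
    unfold-disc : ∀ k l u → (l - u) * (l - u) - ((l - u) * (l - u) + + 4 * (k - u)) ≡ (u - k) * + 4
    unfold-disc = solve-∀

  f+g≡n-1 : f + g ≡ n - + 1
  f+g≡n-1 = ℤP.*-cancelʳ-≡ _ _ (+ 2 * + δ) (begin
    (f + g) * (+ 2 * + δ)          ≡⟨ expand f g (+ δ) ⟩
    + 2 * f * + δ + + 2 * g * + δ  ≡⟨ cong₂ _+_ f-def g-def ⟩
    (A - X) + (A + X)              ≡⟨ collect (n - + 1) (+ δ) X ⟩
    (n - + 1) * (+ 2 * + δ)        ∎)
    where
    A X : ℤ
    A = (n - + 1) * + δ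
    X = + 2 * k + (n - + 1) * (l - u)
    expand : ∀ f g d → (f + g) * (+ 2 * d) ≡ + 2 * f * d + + 2 * g * d
    expand = solve-∀
    collect : ∀ a d X → (a * d - X) + (a * d + X) ≡ a * (+ 2 * d)
    collect = solve-∀

  f*r+g*s≡-k : f * r + g * s ≡ - k
  f*r+g*s≡-k = ℤP.*-cancelʳ-≡ _ _ (+ 4 * + δ) (begin
    (f * r + g * s) * (+ 4 * + δ)
      ≡⟨ expand f g r s (+ δ) ⟩
    (+ 2 * f * + δ) * (+ 2 * r) + (+ 2 * g * + δ) * (+ 2 * s)
      ≡⟨ cong₂ _+_ (cong₂ _*_ f-def r-def) (cong₂ _*_ g-def s-def) ⟩
    (A - X) * (l - u + + δ) + (A + X) * (l - u - + δ)
      ≡⟨ collect n k l u (+ δ) ⟩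
    - k * (+ 4 * + δ) ∎)
    where
    A X : ℤ
    A = (n - + 1) * + δ
    X = + 2 * k + (n - + 1) * (l - u)
    expand : ∀ f g r s d →
      (f * r + g * s) * (+ 4 * d) ≡ (+ 2 * f * d) * (+ 2 * r) + (+ 2 * g * d) * (+ 2 * s)
    expand = solve-∀
    collect : ∀ n k l u d →
      ((n - + 1) * d - (+ 2 * k + (n - + 1) * (l - u))) * (l - u + d)
        + ((n - + 1) * d + (+ 2 * k + (n - + 1) * (l - u))) * (l - u - d) ≡ - k * (+ 4 * d)
    collect = solve-∀

[k-r]*[k-s]≡u*n : ∀ {n k l u r s f g} → (n - k - + 1) * u ≡ k * (k - l - + 1) →
                  Spectrum n k l u r s f g → (k - r) * (k - s) ≡ u * n
[k-r]*[k-s]≡u*n {n} {k} {l} {u} {r} {s} srg sp = begin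
  (k - r) * (k - s)                         ≡⟨ expand k r s ⟩
  k * k - k * (r + s) + r * s               ≡⟨ cong₂ (λ a b → k * k - k * a + b) (r+s≡l-u sp) (r*s≡u-k sp) ⟩
  k * k - k * (l - u) + (u - k)             ≡⟨ regroup k l u ⟩
  k * (k - l - + 1) + (k + + 1) * u         ≡⟨ cong (λ t → t + (k + + 1) * u) (sym srg) ⟩
  (n - k - + 1) * u + (k + + 1) * u         ≡⟨ collect n k u ⟩
  u * n                                     ∎
  where
  expand : ∀ k r s → (k - r) * (k - s) ≡ k * k - k * (r + s) + r * s
  expand = solve-∀
  regroup : ∀ k l u → k * k - k * (l - u) + (u - k) ≡ k * (k - l - + 1) + (k + + 1) * u
  regroup = solve-∀
  collect : ∀ n k u → (n - k - + 1) * u + (k + + 1) * u ≡ u * n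
  collect = solve-∀

module CliquePartition {n k l u r s f g : ℤ}
  (srg : (n - k - + 1) * u ≡ k * (k - l - + 1)) (sp : Spectrum n k l u r s f g)
  (ω m q : ℤ) (2≤ω : + 2 ≤ ω)
  (m[ω[ω-1]]≡nk : m * (ω * (ω - + 1)) ≡ n * k) (q[ω-1]≡k : q * (ω - + 1) ≡ k) where

  n*q≡m*ω : n * q ≡ m * ω
  n*q≡m*ω = ℤP.*-cancelʳ-≡ _ _ (ω - + 1) (begin
    n * q * (ω - + 1)   ≡⟨ ℤP.*-assoc n q _ ⟩
    n * (q * (ω - + 1)) ≡⟨ cong (n *_) q[ω-1]≡k ⟩
    n * k               ≡⟨ sym m[ω[ω-1]]≡nk ⟩
    m * (ω * (ω - + 1)) ≡⟨ sym (ℤP.*-assoc m ω _) ⟩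
    m * ω * (ω - + 1)   ∎)
    where
    instance
      ω-1≢0 : NonZero (ω - + 1)
      ω-1≢0 = >-nonZero (ℤP.<-≤-trans (+<+ (s≤s z≤n)) (ℤP.+-monoˡ-≤ (- + 1) 2≤ω))

  n*[q+k]≡ω*ω*m : n * (q + k) ≡ ω * ω * m
  n*[q+k]≡ω*ω*m = begin
    n * (q + k)                   ≡⟨ ℤP.*-distribˡ-+ n q k ⟩
    n * q + n * k                 ≡⟨ cong₂ _+_ n*q≡m*ω (sym m[ω[ω-1]]≡nk) ⟩
    m * ω + m * (ω * (ω - + 1))   ≡⟨ collect m ω ⟩
    ω * ω * m                     ∎
    where
    collect : ∀ m ω → m * ω + m * (ω * (ω - + 1)) ≡ ω * ω * m
    collect = solve-∀

  -- If the edges are partitioned into m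
  -- cliques of size ω with n × m vertex–clique incidence matrix N, then
  -- N Nᵀ = A + q I, Nᵀ N has the same nonzero spectrum plus m - n zeros,
  -- and Nᵀ N - ω I is the adjacency matrix of the clique graph.
  spectrum-NNᵀ spectrum-NᵀN : List (ℤ × ℤ)
  spectrum-NNᵀ = (+ 1 , q + k) ∷ (f , q + r) ∷ (g , q + s) ∷ []
  spectrum-NᵀN = (m - n , + 0) ∷ spectrum-NNᵀ

  P : ℕ → ℤ
  P = powerSum spectrum-NNᵀ

  P0≡n : P 0 ≡ n
  P0≡n = begin
    P 0             ≡⟨ expand f g ⟩
    + 1 + (f + g)   ≡⟨ cong (_+_ (+ 1)) (f+g≡n-1 sp) ⟩
    + 1 + (n - + 1) ≡⟨ collect n ⟩
    n               ∎
    where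
    expand : ∀ f g → + 1 * + 1 + (f * + 1 + (g * + 1 + + 0)) ≡ + 1 + (f + g)
    expand = solve-∀
    collect : ∀ n → + 1 + (n - + 1) ≡ n
    collect = solve-∀

  P1≡n*q : P 1 ≡ n * q
  P1≡n*q = begin
    P 1
      ≡⟨ expand q k r s f g ⟩
    q * (+ 1 + (f + g)) + (k + (f * r + g * s))
      ≡⟨ cong₂ (λ a b → q * (+ 1 + a) + (k + b)) (f+g≡n-1 sp) (f*r+g*s≡-k sp) ⟩
    q * (+ 1 + (n - + 1)) + (k + - k)
      ≡⟨ collect n k q ⟩
    n * q ∎
    where
    expand : ∀ q k r s f g →
      + 1 * ((q + k) * + 1) + (f * ((q + r) * + 1) + (g * ((q + s) * + 1) + + 0)) ≡
      q * (+ 1 + (f + g)) + (k + (f * r + g * s))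
    expand = solve-∀
    collect : ∀ n k q → q * (+ 1 + (n - + 1)) + (k + - k) ≡ n * q
    collect = solve-∀

  P-recurrence : ∀ j → P (suc (suc j)) ≡
    (q + r + (q + s)) * P (suc j) - (q + r) * (q + s) * P j + u * n * (q + k) ^ j
  P-recurrence j =
    trans (powerSum-three-recurrence (+ 1) f g (q + k) (q + r) (q + s) j)
          (cong (λ d → (q + r + (q + s)) * P (suc j) - (q + r) * (q + s) * P j + d * (q + k) ^ j) gap)
    where
    cancel-q : ∀ q k r s → + 1 * ((q + k - (q + r)) * (q + k - (q + s))) ≡ (k - r) * (k - s)
    cancel-q = solve-∀
    gap : + 1 * ((q + k - (q + r)) * (q + k - (q + s))) ≡ u * n
    gap = trans (cancel-q q k r s) ([k-r]*[k-s]≡u*n srg sp)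

  m∣P1 : m Signed.∣ P 1
  m∣P1 = divides ω (trans P1≡n*q (trans n*q≡m*ω (ℤP.*-comm m ω)))

  m∣P2 : m Signed.∣ P 2
  m∣P2 = divides (q * ω + ω * (ω - + 1)) (begin
    P 2
      ≡⟨ P-recurrence 0 ⟩
    (q + r + (q + s)) * P 1 - (q + r) * (q + s) * P 0 + u * n * + 1
      ≡⟨ cong₂ (λ a b → (q + r + (q + s)) * a - (q + r) * (q + s) * b + u * n * + 1) P1≡n*q P0≡n ⟩
    (q + r + (q + s)) * (n * q) - (q + r) * (q + s) * n + u * n * + 1
      ≡⟨ expand n q r s u ⟩
    n * q * q + n * (u - r * s)       ≡⟨ cong (λ t → n * q * q + n * (u - t)) (r*s≡u-k sp) ⟩
    n * q * q + n * (u - (u - k))     ≡⟨ cancel-u n q u k ⟩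
    n * q * q + n * k                 ≡⟨ cong₂ (λ a b → a * q + b) n*q≡m*ω (sym m[ω[ω-1]]≡nk) ⟩
    m * ω * q + m * (ω * (ω - + 1))   ≡⟨ collect m ω q ⟩
    (q * ω + ω * (ω - + 1)) * m       ∎)
    where
    expand : ∀ n q r s u →
      (q + r + (q + s)) * (n * q) - (q + r) * (q + s) * n + u * n * + 1 ≡ n * q * q + n * (u - r * s)
    expand = solve-∀
    cancel-u : ∀ n q u k → n * q * q + n * (u - (u - k)) ≡ n * q * q + n * k
    cancel-u = solve-∀
    collect : ∀ m ω q → m * ω * q + m * (ω * (ω - + 1)) ≡ (q * ω + ω * (ω - + 1)) * m
    collect = solve-∀

  m∣u*n*[q+k]^suc : ∀ j → m Signed.∣ u * n * (q + k) ^ suc j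
  m∣u*n*[q+k]^suc j = divides (u * X * (ω * ω)) (begin
    u * n * ((q + k) * X)   ≡⟨ regroup u n (q + k) X ⟩
    u * X * (n * (q + k))   ≡⟨ cong (u * X *_) n*[q+k]≡ω*ω*m ⟩
    u * X * (ω * ω * m)     ≡⟨ sym (ℤP.*-assoc (u * X) (ω * ω) m) ⟩
    u * X * (ω * ω) * m     ∎)
    where
    X = (q + k) ^ j
    regroup : ∀ u n y X → u * n * (y * X) ≡ u * X * (n * y)
    regroup = solve-∀

  m∣P : ∀ j → m Signed.∣ P (suc j)
  m∣P = ∣-recurrence P (λ j → u * n * (q + k) ^ j) (q + r + (q + s)) ((q + r) * (q + s))
                     P-recurrence m∣P1 m∣P2 m∣u*n*[q+k]^suc

  m∣powerSum-NᵀN : ∀ j → m Signed.∣ powerSum spectrum-NᵀN j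
  m∣powerSum-NᵀN zero    = divides (+ 1) (begin
    (m - n) * + 1 + P 0 ≡⟨ cong (_+_ ((m - n) * + 1)) P0≡n ⟩
    (m - n) * + 1 + n   ≡⟨ collect m n ⟩
    + 1 * m             ∎)
    where
    collect : ∀ m n → (m - n) * + 1 + n ≡ + 1 * m
    collect = solve-∀
  m∣powerSum-NᵀN (suc j) =
    subst (m Signed.∣_) (sym (powerSum-zeroNode (m - n) spectrum-NNᵀ j)) (m∣P j)

  q+k-ω≡ω*[q-1] : q + k - ω ≡ ω * (q - + 1)
  q+k-ω≡ω*[q-1] = begin
    q + k - ω               ≡⟨ cong (λ t → q + t - ω) (sym q[ω-1]≡k) ⟩
    q + q * (ω - + 1) - ω   ≡⟨ collect q ω ⟩
    ω * (q - + 1)           ∎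
    where
    collect : ∀ q ω → q + q * (ω - + 1) - ω ≡ ω * (q - + 1)
    collect = solve-∀

  powerSum-translate-NᵀN : ∀ ℓ → powerSum (translate (- ω) spectrum-NᵀN) ℓ ≡
    (ω * (q - + 1)) ^ ℓ + f * (q + r - ω) ^ ℓ + g * (q + s - ω) ^ ℓ + (m - n) * (- ω) ^ ℓ
  powerSum-translate-NᵀN ℓ = begin
    (m - n) * (+ 0 - ω) ^ ℓ + (+ 1 * (q + k - ω) ^ ℓ + (f * B ^ ℓ + (g * C ^ ℓ + + 0)))
      ≡⟨ cong₂ (λ a b → (m - n) * a ^ ℓ + (+ 1 * b ^ ℓ + (f * B ^ ℓ + (g * C ^ ℓ + + 0))))
               (ℤP.+-identityˡ (- ω)) q+k-ω≡ω*[q-1] ⟩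
    (m - n) * (- ω) ^ ℓ + (+ 1 * (ω * (q - + 1)) ^ ℓ + (f * B ^ ℓ + (g * C ^ ℓ + + 0)))
      ≡⟨ reorder (m - n) f g ((- ω) ^ ℓ) ((ω * (q - + 1)) ^ ℓ) (B ^ ℓ) (C ^ ℓ) ⟩
    (ω * (q - + 1)) ^ ℓ + f * B ^ ℓ + g * C ^ ℓ + (m - n) * (- ω) ^ ℓ ∎
    where
    B C : ℤ
    B = q + r - ω
    C = q + s - ω
    reorder : ∀ d f g W A Y Z → d * W + (+ 1 * A + (f * Y + (g * Z + + 0))) ≡ A + f * Y + g * Z + d * W
    reorder = solve-∀

proposition4p4 : (n k l u r s f g : ℤ) → Feasible n k l u r s f g →
    (ω m q : ℤ) → + 2 ≤ ω →
    m * (ω * (ω - + 1)) ≡ n * k →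
    q * (ω - + 1) ≡ k →
    (ℓ : ℕ) →
    m ∣ ((ω * (q - + 1)) ^ ℓ + f * (q + r - ω) ^ ℓ + g * (q + s - ω) ^ ℓ
          + (m - n) * (- ω) ^ ℓ)
proposition4p4 n k l u r s f g (srg , sp , _ , _) ω m q 2≤ω m[ω[ω-1]]≡nk q[ω-1]≡k ℓ =
  ∣⇒∣ᵤ (subst (m Signed.∣_) (powerSum-translate-NᵀN ℓ)
          (∣powerSum⇒∣powerSum-translate (- ω) spectrum-NᵀN m∣powerSum-NᵀN ℓ))
  where
  open CliquePartition srg sp ω m q 2≤ω m[ω[ω-1]]≡nk q[ω-1]≡k
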